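{- Let $\mathfrak A_\pi=\mathbb Q\langle\pi,\delta,y\rangle$ with the $q$-shuffle product $\sqcup\!\sqcup$, and $\rho=\pi-\mathbf 1$. Let $\mathfrak A^0_{\mathrm G}$ be the $\mathbb Q$-span of all words $$\rho^{t_1}\pi^{s_1-t_1}y\,\rho^{t_2}\pi^{s_2-t_2}y\cdots\rho^{t_d}\pi^{s_d-t_d}y$$ with $d\ge1$ and integers $1\le t_1\le s_1$ and $0\le t_j\le s_j$ for $2\le j\le d$. Then for all $\mathbf u,\mathbf v\in\mathfrak A^0_{\mathrm G}$ we have $\mathbf u\sqcup\!\sqcup\mathbf v\in\mathfrak A^0_{\mathrm G}$.
   Context: $\mathfrak A_\pi$ is the free noncommutative $\mathbb Q$-algebra on letters $\pi,\delta,y$ (empty word $\mathbf 1$); products like $\rho^{t}\pi^{m}y$ are taken in this algebra. The $q$-shuffle $\sqcup\!\sqcup$ is the bilinear product defined recursively on words by $\mathbf 1\sqcup\!\sqcup\mathbf u=\mathbf u\sqcup\!\sqcup\mathbf 1=\mathbf u$, $(y\mathbf u)\sqcup\!\sqcup\mathbf v=\mathbf u\sqcup\!\sqcup(y\mathbf v)=y(\mathbf u\sqcup\!\sqcup\mathbf v)$, $\pi\mathbf u\sqcup\!\sqcup\pi\mathbf v=\pi(\mathbf u\sqcup\!\sqcup\pi\mathbf v)+\pi(\pi\mathbf u\sqcup\!\sqcup\mathbf v)-\pi(\mathbf u\sqcup\!\sqcup\mathbf v)$, $\delta\mathbf u\sqcup\!\sqcup\delta\mathbf v=\mathbf u\sqcup\!\sqcup\delta\mathbf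 v+\delta\mathbf u\sqcup\!\sqcup\mathbf v-\delta(\mathbf u\sqcup\!\sqcup\mathbf v)$, $\delta\mathbf u\sqcup\!\sqcup\pi\mathbf v=\pi\mathbf v\sqcup\!\sqcup\delta\mathbf u=\delta(\mathbf u\sqcup\!\sqcup\pi\mathbf v)+\delta\mathbf u\sqcup\!\sqcup\mathbf v-\mathbf u\sqcup\!\sqcup\mathbf v$. -}

module Defs where

open import Data.Nat using (ℕ; zero; suc; _∸_; _≤_)
open import Data.Rational using (ℚ; 0ℚ; 1ℚ; -_; _+_; _*_)
open import Data.Product using (_×_; _,_; proj₁; proj₂; ∃)
open import Data.List using (List; []; _∷_; _++_; map; concatMap; foldr)
open import Data.List.Relation.Unary.All using (All)
open import Data.List.Properties using (≡-dec)
open import Relation.Binary.PropositionalEquality using (_≡_; refl)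
open import Relation.Nullary using (yes; no; Dec)

data Letter : Set where
  π δ y : Letter

_≟L_ : (a b : Letter) → Dec (a ≡ b)
π ≟L π = yes refl
π ≟L δ = no (λ ())
π ≟L y = no (λ ())
δ ≟L π = no (λ ())
δ ≟L δ = yes refl
δ ≟L y = no (λ ())
y ≟L π = no (λ ())
y ≟L δ = no (λ ())
y ≟L y = yes refl

Word : Set
Word = List Letter

_≟W_ : (u v : Word) → Dec (u ≡ v)
_≟W_ = ≡-dec _≟L_

-- Elements of 𝔄_π: finite formal Q-linear combinations of words
-- (represented by lists; equality is coefficientwise, see _≈_)

Elem : Set
Elem = List (ℚ × Word)

coeff : Elem → Word → ℚ
coeff [] w = 0ℚ
coeff ((c , w') ∷ e) w with w' ≟W w
... | yes _ = c + coeff e w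
... | no  _ = coeff e w

_≈_ : Elem → Elem → Set
a ≈ b = ∀ w → coeff a w ≡ coeff b w

𝟏 : Elem
𝟏 = (1ℚ , []) ∷ []

word : Word → Elem
word w = (1ℚ , w) ∷ []

infixl 6 _⊕_ _⊖_
infixl 7 _⊙_
infixr 8 _◃_

_⊕_ : Elem → Elem → Elem
a ⊕ b = a ++ b

_·ₛ_ : ℚ → Elem → Elem
c ·ₛ a = map (λ { (d , w) → (c * d , w) }) a

_⊖_ : Elem → Elem → Elem
a ⊖ b = a ⊕ ((- 1ℚ) ·ₛ b)

_⊙_ : Elem → Elem → Elem
a ⊙ b = concatMap (λ { (c , u) → map (λ { (d , v) → (c * d , u ++ v) }) b }) a

_◃_ : Letter → Elem → Elem
l ◃ a = map (λ { (c , w) → (c , l ∷ w) }) a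

_⧢w_ : Word → Word → Elem
[] ⧢w v = word v
(π ∷ u) ⧢w [] = word (π ∷ u)
(δ ∷ u) ⧢w [] = word (δ ∷ u)
(y ∷ u) ⧢w v = y ◃ (u ⧢w v)
(π ∷ u) ⧢w (y ∷ v) = y ◃ ((π ∷ u) ⧢w v)
(δ ∷ u) ⧢w (y ∷ v) = y ◃ ((δ ∷ u) ⧢w v)
(π ∷ u) ⧢w (π ∷ v) =
  (π ◃ (u ⧢w (π ∷ v))) ⊕ (π ◃ ((π ∷ u) ⧢w v)) ⊖ (π ◃ (u ⧢w v))
(δ ∷ u) ⧢w (δ ∷ v) =
  (u ⧢w (δ ∷ v)) ⊕ ((δ ∷ u) ⧢w v) ⊖ (δ ◃ (u ⧢w v))
(δ ∷ u) ⧢w (π ∷ v) =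
  (δ ◃ (u ⧢w (π ∷ v))) ⊕ ((δ ∷ u) ⧢w v) ⊖ (u ⧢w v)
(π ∷ v) ⧢w (δ ∷ u) =
  (δ ◃ (u ⧢w (π ∷ v))) ⊕ ((δ ∷ u) ⧢w v) ⊖ (u ⧢w v)

_⧢_ : Elem → Elem → Elem
a ⧢ b = concatMap (λ { (c , u) → concatMap (λ { (d , v) → (c * d) ·ₛ (u ⧢w v) }) b }) a

ρ : Elem
ρ = word (π ∷ []) ⊖ 𝟏

_^_ : Elem → ℕ → Elem
a ^ zero = 𝟏
a ^ suc n = a ⊙ (a ^ n)

block : ℕ × ℕ → Elem
block (t , s) = (ρ ^ t) ⊙ ((word (π ∷ []) ^ (s ∸ t)) ⊙ word (y ∷ []))

genWord : List (ℕ × ℕ) → Elem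
genWord [] = 𝟏
genWord (b ∷ bs) = block b ⊙ genWord bs

data Admissible : List (ℕ × ℕ) → Set where
  adm : ∀ {t s bs} → 1 ≤ t → t ≤ s →
        All (λ b → proj₁ b ≤ proj₂ b) bs → Admissible ((t , s) ∷ bs)

lincomb : List (ℚ × List (ℕ × ℕ)) → Elem
lincomb [] = []
lincomb ((c , i) ∷ cs) = (c ·ₛ genWord i) ⊕ lincomb cs

InAG0 : Elem → Set
InAG0 u = ∃ λ (cs : List (ℚ × List (ℕ × ℕ))) →
  All (λ ci → Admissible (proj₂ ci)) cs × (u ≈ lincomb cs)

module Submission where

-- Elements are compared through
-- functionals: each h : Word → ℚ extends linearly to ⟨ h ∣ _ ⟩, and elements
-- are equal iff all functionals agree.  Spanning words of 𝔄⁰_G and their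
-- shuffles live on words π^m y t with t a product of blocks π^a y.  The
-- telescoping identity
--     π^m y t = Σ_{j<m} ρ π^j y t + y t
-- writes any X supported on such words as an explicit combination of
-- admissible spanning words plus X with its leading π's stripped.  For
-- X = u ⧢ v with u, v in 𝔄⁰_G the stripped part vanishes: the recursive
-- definition of ⧢ expresses it through terms in which one factor enters
-- only via its part after the first y; such functionals are π-invariant,
-- hence kill every spanning word (which begins with ρ).

open import Defs
open import Data.Nat using (ℕ; zero; suc; _∸_; _≤_; z≤n; s≤s)
open import Data.Nat.Properties using (≤-refl; ≤-trans; n≤1+n)
open import Data.Rational using (ℚ; 0ℚ; 1ℚ; -_; _+_; _*_; _-_)
open import Data.Rational.Properties
  using (+-*-commutativeRing; _≟_; +-identityˡ; +-identityʳ; +-assoc)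
open import Data.Product using (_×_; _,_; proj₁; proj₂)
open import Data.List using (List; []; _∷_; _++_; map; concatMap; length; replicate)
open import Data.List.Properties using (++-assoc)
open import Data.List.Relation.Unary.All as All using (All; []; _∷_)
open import Data.List.Relation.Unary.All.Properties using (++⁺)
open import Data.Empty using (⊥; ⊥-elim)
open import Data.Unit using (⊤; tt)
open import Function using (_∘_)
open import Relation.Nullary using (yes; no; ¬_)
open import Relation.Binary.PropositionalEquality
  using (_≡_; refl; sym; trans; cong; cong₂; subst; module ≡-Reasoning)
import Algebra.Solver.Ring.Simple as RingSolver
import Algebra.Solver.Ring.AlmostCommutativeRing as ACR

open RingSolver (ACR.fromCommutativeRing +-*-commutativeRing) _≟_
  using (solve; _:+_; _:*_; _:-_; _:=_; con)
open ≡-Reasoning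

⟨_∣_⟩ : (Word → ℚ) → Elem → ℚ
⟨ h ∣ [] ⟩ = 0ℚ
⟨ h ∣ (c , w) ∷ a ⟩ = c * h w + ⟨ h ∣ a ⟩

⟪_∣_∣_⟫ : (Word → Word → ℚ) → Elem → Elem → ℚ
⟪ f ∣ a ∣ b ⟫ = ⟨ (λ u → ⟨ f u ∣ b ⟩) ∣ a ⟩

AllWords : (Word → Set) → Elem → Set
AllWords P a = All (λ e → P (proj₂ e)) a

⟨⟩-++ : ∀ h a b → ⟨ h ∣ a ++ b ⟩ ≡ ⟨ h ∣ a ⟩ + ⟨ h ∣ b ⟩
⟨⟩-++ h [] b = sym (+-identityˡ _)
⟨⟩-++ h ((c , w) ∷ a) b =
  trans (cong (c * h w +_) (⟨⟩-++ h a b)) (sym (+-assoc (c * h w) ⟨ h ∣ a ⟩ ⟨ h ∣ b ⟩))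

⟨⟩-rescale : ∀ h k (f : Word → Word) a →
  ⟨ h ∣ map (λ { (d , v) → (k * d , f v) }) a ⟩ ≡ k * ⟨ h ∘ f ∣ a ⟩
⟨⟩-rescale h k f [] = solve 1 (λ k → con 0ℚ := k :* con 0ℚ) refl k
⟨⟩-rescale h k f ((d , v) ∷ a) =
  trans (cong (k * d * h (f v) +_) (⟨⟩-rescale h k f a))
    (solve 4 (λ k d x r → k :* d :* x :+ k :* r := k :* (d :* x :+ r))
       refl k d (h (f v)) (⟨ h ∘ f ∣ a ⟩))

⟨⟩-·ₛ : ∀ h c a → ⟨ h ∣ c ·ₛ a ⟩ ≡ c * ⟨ h ∣ a ⟩
⟨⟩-·ₛ h c a = ⟨⟩-rescale h c (λ w → w) a

⟨⟩-⊖ : ∀ h a b → ⟨ h ∣ a ⊖ b ⟩ ≡ ⟨ h ∣ a ⟩ - ⟨ h ∣ b ⟩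
⟨⟩-⊖ h a b = begin
  ⟨ h ∣ a ⊖ b ⟩                         ≡⟨ ⟨⟩-++ h a ((- 1ℚ) ·ₛ b) ⟩
  ⟨ h ∣ a ⟩ + ⟨ h ∣ (- 1ℚ) ·ₛ b ⟩        ≡⟨ cong (⟨ h ∣ a ⟩ +_) (⟨⟩-·ₛ h (- 1ℚ) b) ⟩
  ⟨ h ∣ a ⟩ + (- 1ℚ) * ⟨ h ∣ b ⟩         ≡⟨ solve 2 (λ p q → p :+ con (- 1ℚ) :* q := p :- q)
                                               refl ⟨ h ∣ a ⟩ ⟨ h ∣ b ⟩ ⟩
  ⟨ h ∣ a ⟩ - ⟨ h ∣ b ⟩                  ∎

⟨⟩-◃ : ∀ h l a → ⟨ h ∣ l ◃ a ⟩ ≡ ⟨ h ∘ (l ∷_) ∣ a ⟩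
⟨⟩-◃ h l [] = refl
⟨⟩-◃ h l ((c , w) ∷ a) = cong (c * h (l ∷ w) +_) (⟨⟩-◃ h l a)

⟨⟩-word : ∀ h w → ⟨ h ∣ word w ⟩ ≡ h w
⟨⟩-word h w = solve 1 (λ x → con 1ℚ :* x :+ con 0ℚ := x) refl (h w)

⟨⟩-cong-on : ∀ {P : Word → Set} {f g : Word → ℚ} a → AllWords P a →
  (∀ w → P w → f w ≡ g w) → ⟨ f ∣ a ⟩ ≡ ⟨ g ∣ a ⟩
⟨⟩-cong-on [] [] e = refl
⟨⟩-cong-on ((c , w) ∷ a) (p ∷ ps) e =
  cong₂ (λ x r → c * x + r) (e w p) (⟨⟩-cong-on a ps e)

⟨⟩-cong : ∀ {f g : Word → ℚ} → (∀ w → f w ≡ g w) → ∀ a → ⟨ f ∣ a ⟩ ≡ ⟨ g ∣ a ⟩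
⟨⟩-cong e [] = refl
⟨⟩-cong e ((c , w) ∷ a) = cong₂ (λ x r → c * x + r) (e w) (⟨⟩-cong e a)

⟨⟩-+ : ∀ f g a → ⟨ (λ w → f w + g w) ∣ a ⟩ ≡ ⟨ f ∣ a ⟩ + ⟨ g ∣ a ⟩
⟨⟩-+ f g [] = sym (+-identityˡ 0ℚ)
⟨⟩-+ f g ((c , w) ∷ a) =
  trans (cong (c * (f w + g w) +_) (⟨⟩-+ f g a))
    (solve 5 (λ c x z p q → c :* (x :+ z) :+ (p :+ q) := (c :* x :+ p) :+ (c :* z :+ q))
       refl c (f w) (g w) ⟨ f ∣ a ⟩ ⟨ g ∣ a ⟩)

⟨⟩-⊙ : ∀ h a b → ⟨ h ∣ a ⊙ b ⟩ ≡ ⟨ (λ u → ⟨ h ∘ (u ++_) ∣ b ⟩) ∣ a ⟩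
⟨⟩-⊙ h [] b = refl
⟨⟩-⊙ h ((c , u) ∷ a) b =
  trans (⟨⟩-++ h (map (λ { (d , v) → (c * d , u ++ v) }) b) (a ⊙ b))
    (cong₂ _+_ (⟨⟩-rescale h c (u ++_) b) (⟨⟩-⊙ h a b))

⟨⟩-⧢ : ∀ h a b → ⟨ h ∣ a ⧢ b ⟩ ≡ ⟪ (λ u v → ⟨ h ∣ u ⧢w v ⟩) ∣ a ∣ b ⟫
⟨⟩-⧢ h [] b = refl
⟨⟩-⧢ h ((c , u) ∷ a) b =
  trans (⟨⟩-++ h (row b) (a ⧢ b)) (cong₂ _+_ (⟨⟩-row b) (⟨⟩-⧢ h a b))
  where
  row : Elem → Elem
  row = concatMap (λ { (d , v) → (c * d) ·ₛ (u ⧢w v) })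
  ⟨⟩-row : ∀ b → ⟨ h ∣ row b ⟩ ≡ c * ⟨ (λ v → ⟨ h ∣ u ⧢w v ⟩) ∣ b ⟩
  ⟨⟩-row [] = solve 1 (λ c → con 0ℚ := c :* con 0ℚ) refl c
  ⟨⟩-row ((d , v) ∷ b) = begin
    ⟨ h ∣ (c * d) ·ₛ (u ⧢w v) ++ row b ⟩
      ≡⟨ ⟨⟩-++ h ((c * d) ·ₛ (u ⧢w v)) (row b) ⟩
    ⟨ h ∣ (c * d) ·ₛ (u ⧢w v) ⟩ + ⟨ h ∣ row b ⟩
      ≡⟨ cong₂ _+_ (⟨⟩-·ₛ h (c * d) (u ⧢w v)) (⟨⟩-row b) ⟩
    c * d * ⟨ h ∣ u ⧢w v ⟩ + c * ⟨ (λ v → ⟨ h ∣ u ⧢w v ⟩) ∣ b ⟩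
      ≡⟨ solve 4 (λ c d x r → c :* d :* x :+ c :* r := c :* (d :* x :+ r)) refl
           c d ⟨ h ∣ u ⧢w v ⟩ ⟨ (λ v → ⟨ h ∣ u ⧢w v ⟩) ∣ b ⟩ ⟩
    c * ⟨ (λ v → ⟨ h ∣ u ⧢w v ⟩) ∣ (d , v) ∷ b ⟩
      ∎

_≋_ : Elem → Elem → Set
a ≋ b = ∀ h → ⟨ h ∣ a ⟩ ≡ ⟨ h ∣ b ⟩

indicator : Word → Word → ℚ
indicator w u with u ≟W w
... | yes _ = 1ℚ
... | no  _ = 0ℚ

coeff-indicator : ∀ a w → coeff a w ≡ ⟨ indicator w ∣ a ⟩
coeff-indicator [] w = refl
coeff-indicator ((c , u) ∷ a) w with u ≟W w
... | yes _ = cong₂ _+_ (solve 1 (λ c → c := c :* con 1ℚ) refl c) (coeff-indicator a w)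
... | no  _ = trans (coeff-indicator a w)
                (solve 2 (λ c r → r := c :* con 0ℚ :+ r) refl c ⟨ indicator w ∣ a ⟩)

≋⇒≈ : ∀ a b → a ≋ b → a ≈ b
≋⇒≈ a b e w =
  trans (coeff-indicator a w) (trans (e (indicator w)) (sym (coeff-indicator b w)))

remove : Word → Elem → Elem
remove v [] = []
remove v ((c , w) ∷ a) with w ≟W v
... | yes _ = remove v a
... | no  _ = (c , w) ∷ remove v a

⟨⟩-remove : ∀ h v a → ⟨ h ∣ a ⟩ ≡ coeff a v * h v + ⟨ h ∣ remove v a ⟩
⟨⟩-remove h v [] = solve 1 (λ x → con 0ℚ := con 0ℚ :* x :+ con 0ℚ) refl (h v)
⟨⟩-remove h v ((c , w) ∷ a) with w ≟W v
... | yes refl = trans (cong (c * h w +_) (⟨⟩-remove h v a))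
  (solve 4 (λ c x k r → c :* x :+ (k :* x :+ r) := (c :+ k) :* x :+ r)
     refl c (h w) (coeff a v) ⟨ h ∣ remove v a ⟩)
... | no  _ = trans (cong (c * h w +_) (⟨⟩-remove h v a))
  (solve 5 (λ c x k z r → c :* x :+ (k :* z :+ r) := k :* z :+ (c :* x :+ r))
     refl c (h w) (coeff a v) (h v) ⟨ h ∣ remove v a ⟩)

coeff-head : ∀ c v a → coeff ((c , v) ∷ a) v ≡ c + coeff a v
coeff-head c v a with v ≟W v
... | yes _ = refl
... | no ne = ⊥-elim (ne refl)

coeff-tail : ∀ c v a w → ¬ v ≡ w → coeff ((c , v) ∷ a) w ≡ coeff a w
coeff-tail c v a w ne with v ≟W w
... | yes e = ⊥-elim (ne e)
... | no  _ = refl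

coeff-removed : ∀ v a → coeff (remove v a) v ≡ 0ℚ
coeff-removed v [] = refl
coeff-removed v ((c , w) ∷ a) with w ≟W v
... | yes _ = coeff-removed v a
... | no ne = trans (coeff-tail c w (remove v a) v ne) (coeff-removed v a)

coeff-remove : ∀ v w a → ¬ v ≡ w → coeff (remove v a) w ≡ coeff a w
coeff-remove v w [] ne = refl
coeff-remove v w ((c , u) ∷ a) ne with u ≟W v
... | yes refl = trans (coeff-remove v w a ne) (sym (coeff-tail c u a w ne))
... | no  _ with u ≟W w
...   | yes _ = cong (c +_) (coeff-remove v w a ne)
...   | no  _ = coeff-remove v w a ne

-- Removing occurrences does not lengthen the list (the induction measure).
length-remove : ∀ v a → length (remove v a) ≤ length a
length-remove v [] = z≤n
length-remove v ((c , w) ∷ a) with w ≟W v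
... | yes _ = ≤-trans (length-remove v a) (n≤1+n _)
... | no  _ = s≤s (length-remove v a)

Null : Elem → Set
Null a = ∀ w → coeff a w ≡ 0ℚ

remove-null : ∀ c v a → Null ((c , v) ∷ a) → Null (remove v a)
remove-null c v a z w with v ≟W w
... | yes refl = coeff-removed v a
... | no  ne = trans (coeff-remove v w a ne) (trans (sym (coeff-tail c v a w ne)) (z w))

null-annihilated : ∀ n a → length a ≤ n → Null a → ∀ h → ⟨ h ∣ a ⟩ ≡ 0ℚ
null-annihilated _ [] _ _ h = refl
null-annihilated (suc n) ((c , v) ∷ a) (s≤s len) z h = begin
  c * h v + ⟨ h ∣ a ⟩
    ≡⟨ cong (c * h v +_) (⟨⟩-remove h v a) ⟩
  c * h v + (coeff a v * h v + ⟨ h ∣ remove v a ⟩)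
    ≡⟨ solve 4 (λ c x k r → c :* x :+ (k :* x :+ r) := (c :+ k) :* x :+ r)
         refl c (h v) (coeff a v) ⟨ h ∣ remove v a ⟩ ⟩
  (c + coeff a v) * h v + ⟨ h ∣ remove v a ⟩
    ≡⟨ cong₂ (λ k r → k * h v + r) (trans (sym (coeff-head c v a)) (z v))
         (null-annihilated n (remove v a) (≤-trans (length-remove v a) len)
            (remove-null c v a z) h) ⟩
  0ℚ * h v + 0ℚ
    ≡⟨ solve 1 (λ x → con 0ℚ :* x :+ con 0ℚ := con 0ℚ) refl (h v) ⟩
  0ℚ ∎

-- Conversely, equal elements agree under every functional: their
-- difference is null.
≈⇒≋ : ∀ a b → a ≈ b → a ≋ b
≈⇒≋ a b e h = begin
  ⟨ h ∣ a ⟩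
    ≡⟨ solve 2 (λ p q → p := (p :- q) :+ q) refl ⟨ h ∣ a ⟩ ⟨ h ∣ b ⟩ ⟩
  (⟨ h ∣ a ⟩ - ⟨ h ∣ b ⟩) + ⟨ h ∣ b ⟩
    ≡⟨ cong (_+ ⟨ h ∣ b ⟩) (sym (⟨⟩-⊖ h a b)) ⟩
  ⟨ h ∣ a ⊖ b ⟩ + ⟨ h ∣ b ⟩
    ≡⟨ cong (_+ ⟨ h ∣ b ⟩) (null-annihilated _ (a ⊖ b) ≤-refl null h) ⟩
  0ℚ + ⟨ h ∣ b ⟩
    ≡⟨ +-identityˡ _ ⟩
  ⟨ h ∣ b ⟩
    ∎
  where
  null : Null (a ⊖ b)
  null w = begin
    coeff (a ⊖ b) w
      ≡⟨ coeff-indicator (a ⊖ b) w ⟩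
    ⟨ indicator w ∣ a ⊖ b ⟩
      ≡⟨ ⟨⟩-⊖ (indicator w) a b ⟩
    ⟨ indicator w ∣ a ⟩ - ⟨ indicator w ∣ b ⟩
      ≡⟨ cong₂ _-_ (sym (coeff-indicator a w)) (sym (coeff-indicator b w)) ⟩
    coeff a w - coeff b w
      ≡⟨ cong (_- coeff b w) (e w) ⟩
    coeff b w - coeff b w
      ≡⟨ solve 1 (λ x → x :- x := con 0ℚ) refl (coeff b w) ⟩
    0ℚ
      ∎

⧢-cong : ∀ a a′ b b′ → a ≋ a′ → b ≋ b′ → (a ⧢ b) ≋ (a′ ⧢ b′)
⧢-cong a a′ b b′ ea eb h = begin
  ⟨ h ∣ a ⧢ b ⟩       ≡⟨ ⟨⟩-⧢ h a b ⟩
  ⟪ sh ∣ a ∣ b ⟫      ≡⟨ ea _ ⟩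
  ⟪ sh ∣ a′ ∣ b ⟫     ≡⟨ ⟨⟩-cong (λ u → eb (sh u)) a′ ⟩
  ⟪ sh ∣ a′ ∣ b′ ⟫    ≡⟨ sym (⟨⟩-⧢ h a′ b′) ⟩
  ⟨ h ∣ a′ ⧢ b′ ⟩     ∎
  where
  sh : Word → Word → ℚ
  sh u v = ⟨ h ∣ u ⧢w v ⟩

AllWords-rescale : ∀ {P : Word → Set} k (f : Word → Word) a → AllWords (P ∘ f) a →
  AllWords P (map (λ { (d , v) → (k * d , f v) }) a)
AllWords-rescale k f [] [] = []
AllWords-rescale k f ((d , v) ∷ a) (p ∷ ps) = p ∷ AllWords-rescale k f a ps

AllWords-·ₛ : ∀ {P : Word → Set} c a → AllWords P a → AllWords P (c ·ₛ a)
AllWords-·ₛ c a = AllWords-rescale c (λ w → w) a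

AllWords-◃ : ∀ {P : Word → Set} l a → AllWords (P ∘ (l ∷_)) a → AllWords P (l ◃ a)
AllWords-◃ l [] [] = []
AllWords-◃ l ((d , w) ∷ a) (p ∷ ps) = p ∷ AllWords-◃ l a ps

AllWords-⊖ : ∀ {P : Word → Set} a b → AllWords P a → AllWords P b → AllWords P (a ⊖ b)
AllWords-⊖ a b pa pb = ++⁺ pa (AllWords-·ₛ (- 1ℚ) b pb)

AllWords-⊙ : ∀ {P Q R : Word → Set} a b → AllWords P a → AllWords Q b →
  (∀ u v → P u → Q v → R (u ++ v)) → AllWords R (a ⊙ b)
AllWords-⊙ [] b [] qb f = []
AllWords-⊙ ((c , u) ∷ a) b (p ∷ pa) qb f =
  ++⁺ (AllWords-rescale c (u ++_) b (All.map (f u _ p) qb)) (AllWords-⊙ a b pa qb f)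

AllWords-⧢ : ∀ {P Q R : Word → Set} a b → AllWords P a → AllWords Q b →
  (∀ u v → P u → Q v → AllWords R (u ⧢w v)) → AllWords R (a ⧢ b)
AllWords-⧢ [] b [] qb f = []
AllWords-⧢ {R = R} ((c , u) ∷ a) b (p ∷ pa) qb f = ++⁺ (row b qb) (AllWords-⧢ a b pa qb f)
  where
  row : ∀ b → AllWords _ b →
    AllWords R (concatMap (λ { (d , v) → (c * d) ·ₛ (u ⧢w v) }) b)
  row [] [] = []
  row ((d , v) ∷ b) (q ∷ qs) = ++⁺ (AllWords-·ₛ (c * d) (u ⧢w v) (f u v p q)) (row b qs)

NonEmpty : Word → Set
NonEmpty [] = ⊥
NonEmpty (_ ∷ _) = ⊤

-- Blocks w: w is a (possibly empty) concatenation of blocks π^a y, i.e.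
-- w has no δ and does not end with π.  Blocks⁺ w: moreover w ≠ [].
Blocks : Word → Set
Blocks⁺ : Word → Set
Blocks [] = ⊤
Blocks (π ∷ w) = Blocks⁺ w
Blocks (δ ∷ w) = ⊥
Blocks (y ∷ w) = Blocks w
Blocks⁺ w = NonEmpty w × Blocks w

NonEmpty-++ : ∀ u v → NonEmpty u → NonEmpty (u ++ v)
NonEmpty-++ (_ ∷ _) v _ = tt

Blocks-++ : ∀ u v → Blocks u → Blocks v → Blocks (u ++ v)
Blocks-++ [] v _ bv = bv
Blocks-++ (y ∷ u) v bu bv = Blocks-++ u v bu bv
Blocks-++ (π ∷ u) v (nu , bu) bv = NonEmpty-++ u v nu , Blocks-++ u v bu bv

Blocks⁺-++ : ∀ u v → Blocks⁺ u → Blocks v → Blocks⁺ (u ++ v)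
Blocks⁺-++ u v (nu , bu) bv = NonEmpty-++ u v nu , Blocks-++ u v bu bv

PowerOfπ : Word → Set
PowerOfπ [] = ⊤
PowerOfπ (π ∷ p) = PowerOfπ p
PowerOfπ _ = ⊥

PowerOfπ-++ : ∀ p q → PowerOfπ p → PowerOfπ q → PowerOfπ (p ++ q)
PowerOfπ-++ [] q _ pq = pq
PowerOfπ-++ (π ∷ p) q pp pq = PowerOfπ-++ p q pp pq

PowerOfπ-Blocks⁺ : ∀ p w → PowerOfπ p → Blocks⁺ w → Blocks⁺ (p ++ w)
PowerOfπ-Blocks⁺ [] w _ bw = bw
PowerOfπ-Blocks⁺ (π ∷ p) w pp bw = tt , PowerOfπ-Blocks⁺ p w pp bw

Admissibles : List (ℚ × List (ℕ × ℕ)) → Set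
Admissibles cs = All (λ ci → Admissible (proj₂ ci)) cs

πpower-support : ∀ k → AllWords PowerOfπ (word (π ∷ []) ^ k)
πpower-support zero = tt ∷ []
πpower-support (suc k) =
  AllWords-⊙ {PowerOfπ} {PowerOfπ} (word (π ∷ [])) _ (tt ∷ []) (πpower-support k) PowerOfπ-++

ρpower-support : ∀ t → AllWords PowerOfπ (ρ ^ t)
ρpower-support zero = tt ∷ []
ρpower-support (suc t) =
  AllWords-⊙ {PowerOfπ} {PowerOfπ} ρ _ (tt ∷ tt ∷ []) (ρpower-support t) PowerOfπ-++

block-support : ∀ b → AllWords Blocks⁺ (block b)
block-support (t , s) =
  AllWords-⊙ (ρ ^ t) _ (ρpower-support t)
    (AllWords-⊙ {PowerOfπ} {Blocks⁺} (word (π ∷ []) ^ (s ∸ t)) (word (y ∷ []))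
       (πpower-support (s ∸ t)) ((tt , tt) ∷ []) PowerOfπ-Blocks⁺)
    PowerOfπ-Blocks⁺

genWord-support : ∀ bs → AllWords Blocks (genWord bs)
genWord-support [] = tt ∷ []
genWord-support (b ∷ bs) =
  AllWords-⊙ (block b) _ (block-support b) (genWord-support bs)
    (λ u v bu → Blocks-++ u v (proj₂ bu))

genWord⁺-support : ∀ b bs → AllWords Blocks⁺ (genWord (b ∷ bs))
genWord⁺-support b bs =
  AllWords-⊙ (block b) _ (block-support b) (genWord-support bs) Blocks⁺-++

A0-support : ∀ cs → Admissibles cs → AllWords Blocks⁺ (lincomb cs)
A0-support [] [] = []
A0-support ((c , (b ∷ bs)) ∷ cs) (adm _ _ _ ∷ as) =
  ++⁺ (AllWords-·ₛ c (genWord (b ∷ bs)) (genWord⁺-support b bs)) (A0-support cs as)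

AllWords-π◃ : ∀ {P : Word → Set} a b c →
  AllWords (P ∘ (π ∷_)) a → AllWords (P ∘ (π ∷_)) b → AllWords (P ∘ (π ∷_)) c →
  AllWords P (π ◃ a ⊕ π ◃ b ⊖ π ◃ c)
AllWords-π◃ a b c pa pb pc =
  AllWords-⊖ (π ◃ a ⊕ π ◃ b) (π ◃ c)
    (++⁺ (AllWords-◃ π a pa) (AllWords-◃ π b pb)) (AllWords-◃ π c pc)

AllWords-NonEmpty-◃ : ∀ l a → AllWords NonEmpty (l ◃ a)
AllWords-NonEmpty-◃ l a = AllWords-◃ l a (All.universal (λ _ → tt) a)

shuffle-NonEmpty : ∀ u v → NonEmpty u → Blocks u → Blocks v → AllWords NonEmpty (u ⧢w v)
shuffle-NonEmpty (π ∷ u) [] _ _ _ = tt ∷ []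
shuffle-NonEmpty (y ∷ u) v _ _ _ = AllWords-NonEmpty-◃ y (u ⧢w v)
shuffle-NonEmpty (π ∷ u) (y ∷ v) _ _ _ = AllWords-NonEmpty-◃ y ((π ∷ u) ⧢w v)
shuffle-NonEmpty (π ∷ u) (π ∷ v) _ _ _ =
  AllWords-π◃ (u ⧢w (π ∷ v)) ((π ∷ u) ⧢w v) (u ⧢w v)
    (All.universal (λ _ → tt) _) (All.universal (λ _ → tt) _) (All.universal (λ _ → tt) _)

-- The shuffle of two Blocks words is supported on Blocks words; the π/π
-- clause needs the nonemptiness above to keep π from being the last letter.
shuffle-Blocks : ∀ u v → Blocks u → Blocks v → AllWords Blocks (u ⧢w v)
shuffle-Blocks [] v _ bv = bv ∷ []
shuffle-Blocks (π ∷ u) [] bu _ = bu ∷ []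
shuffle-Blocks (y ∷ u) v bu bv = AllWords-◃ y (u ⧢w v) (shuffle-Blocks u v bu bv)
shuffle-Blocks (π ∷ u) (y ∷ v) bu bv =
  AllWords-◃ y ((π ∷ u) ⧢w v) (shuffle-Blocks (π ∷ u) v bu bv)
shuffle-Blocks (π ∷ u) (π ∷ v) bu@(nu , bu′) bv@(nv , bv′) =
  AllWords-π◃ (u ⧢w (π ∷ v)) ((π ∷ u) ⧢w v) (u ⧢w v)
    (All.zip (shuffle-NonEmpty u (π ∷ v) nu bu′ bv , shuffle-Blocks u (π ∷ v) bu′ bv))
    (All.zip (shuffle-NonEmpty (π ∷ u) v tt bu bv′ , shuffle-Blocks (π ∷ u) v bu bv′))
    (All.zip (shuffle-NonEmpty u v nu bu′ bv′ , shuffle-Blocks u v bu′ bv′))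

shuffle-Blocks⁺ : ∀ u v → Blocks⁺ u → Blocks v → AllWords Blocks⁺ (u ⧢w v)
shuffle-Blocks⁺ u v (nu , bu) bv = All.zip (shuffle-NonEmpty u v nu bu bv , shuffle-Blocks u v bu bv)

YHeaded : Word → Set
YHeaded (π ∷ w) = YHeaded w
YHeaded (y ∷ w) = ⊤
YHeaded _ = ⊥

stripπ : Word → Word
stripπ (π ∷ w) = stripπ w
stripπ w = w

tailY : Word → Word
tailY (π ∷ w) = tailY w
tailY (y ∷ w) = w
tailY _ = []

leadπ : Word → ℕ
leadπ (π ∷ w) = suc (leadπ w)
leadπ _ = zero

Blocks⁺-YHeaded : ∀ w → Blocks⁺ w → YHeaded w
Blocks⁺-YHeaded (y ∷ w) _ = tt
Blocks⁺-YHeaded (π ∷ w) (_ , bw) = Blocks⁺-YHeaded w bw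

Blocks⁺-tailY : ∀ w → Blocks⁺ w → Blocks (tailY w)
Blocks⁺-tailY (y ∷ w) (_ , bw) = bw
Blocks⁺-tailY (π ∷ w) (_ , bw) = Blocks⁺-tailY w bw

YHeaded-split : ∀ w → YHeaded w → w ≡ replicate (leadπ w) π ++ y ∷ tailY w
YHeaded-split (π ∷ w) hw = cong (π ∷_) (YHeaded-split w hw)
YHeaded-split (y ∷ w) _ = refl

Invariant : (Word → ℚ) → Set
Invariant g = ∀ w → g (π ∷ w) ≡ g w

⟨⟩-ρ⊙ : ∀ g P → ⟨ g ∣ ρ ⊙ P ⟩ ≡ ⟨ g ∘ (π ∷_) ∣ P ⟩ - ⟨ g ∣ P ⟩
⟨⟩-ρ⊙ g P = trans (⟨⟩-⊙ g ρ P)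
  (solve 2 (λ p q → con 1ℚ :* p :+ (con (- 1ℚ) :* con 1ℚ :* q :+ con 0ℚ) := p :- q)
     refl ⟨ g ∘ (π ∷_) ∣ P ⟩ ⟨ g ∣ P ⟩)

ρ⊙-annihilated : ∀ {g} → Invariant g → ∀ P → ⟨ g ∣ ρ ⊙ P ⟩ ≡ 0ℚ
ρ⊙-annihilated {g} inv P = begin
  ⟨ g ∣ ρ ⊙ P ⟩                    ≡⟨ ⟨⟩-ρ⊙ g P ⟩
  ⟨ g ∘ (π ∷_) ∣ P ⟩ - ⟨ g ∣ P ⟩    ≡⟨ cong (_- ⟨ g ∣ P ⟩) (⟨⟩-cong inv P) ⟩
  ⟨ g ∣ P ⟩ - ⟨ g ∣ P ⟩             ≡⟨ solve 1 (λ x → x :- x := con 0ℚ) refl ⟨ g ∣ P ⟩ ⟩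
  0ℚ                                ∎

invariant-⊙ : ∀ {g} → Invariant g → ∀ Q → Invariant (λ u → ⟨ g ∘ (u ++_) ∣ Q ⟩)
invariant-⊙ inv Q u = ⟨⟩-cong (λ v → inv (u ++ v)) Q

genWord-annihilated : ∀ {g} → Invariant g → ∀ t s bs →
  ⟨ g ∣ genWord ((suc t , s) ∷ bs) ⟩ ≡ 0ℚ
genWord-annihilated {g} inv t s bs = begin
  ⟨ g ∣ ((ρ ⊙ (ρ ^ t)) ⊙ R) ⊙ genWord bs ⟩   ≡⟨ ⟨⟩-⊙ g ((ρ ⊙ (ρ ^ t)) ⊙ R) (genWord bs) ⟩
  ⟨ g₁ ∣ (ρ ⊙ (ρ ^ t)) ⊙ R ⟩                 ≡⟨ ⟨⟩-⊙ g₁ (ρ ⊙ (ρ ^ t)) R ⟩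
  ⟨ (λ u → ⟨ g₁ ∘ (u ++_) ∣ R ⟩) ∣ ρ ⊙ (ρ ^ t) ⟩
    ≡⟨ ρ⊙-annihilated (invariant-⊙ (invariant-⊙ inv (genWord bs)) R) (ρ ^ t) ⟩
  0ℚ                                          ∎
  where
  R : Elem
  R = (word (π ∷ []) ^ (s ∸ suc t)) ⊙ word (y ∷ [])
  g₁ : Word → ℚ
  g₁ u = ⟨ g ∘ (u ++_) ∣ genWord bs ⟩

-- Since admissible indices have t₁ ≥ 1, invariant functionals kill 𝔄⁰_G.
A0-annihilated : ∀ {g} cs → Admissibles cs → Invariant g → ⟨ g ∣ lincomb cs ⟩ ≡ 0ℚ
A0-annihilated [] [] inv = refl
A0-annihilated {g} ((c , ((suc t , s) ∷ bs)) ∷ cs) (adm _ _ _ ∷ as) inv = begin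
  ⟨ g ∣ c ·ₛ genWord i ++ lincomb cs ⟩
    ≡⟨ ⟨⟩-++ g (c ·ₛ genWord i) (lincomb cs) ⟩
  ⟨ g ∣ c ·ₛ genWord i ⟩ + ⟨ g ∣ lincomb cs ⟩
    ≡⟨ cong₂ _+_ (⟨⟩-·ₛ g c (genWord i)) (A0-annihilated cs as inv) ⟩
  c * ⟨ g ∣ genWord i ⟩ + 0ℚ
    ≡⟨ cong (λ x → c * x + 0ℚ) (genWord-annihilated inv t s bs) ⟩
  c * 0ℚ + 0ℚ
    ≡⟨ solve 1 (λ c → c :* con 0ℚ :+ con 0ℚ := con 0ℚ) refl c ⟩
  0ℚ
    ∎
  where
  i : List (ℕ × ℕ)
  i = (suc t , s) ∷ bs

-- A functional seeing only the part after the first y is π-invariant.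
tailY-annihilated : ∀ cs → Admissibles cs → ∀ g → ⟨ g ∘ tailY ∣ lincomb cs ⟩ ≡ 0ℚ
tailY-annihilated cs as g = A0-annihilated cs as (λ _ → refl)

bilinear-annihilated : ∀ cs ds → Admissibles cs → Admissibles ds →
  ∀ (f F G : Word → Word → ℚ) →
  (∀ u v → Blocks⁺ u → Blocks⁺ v → f u v ≡ F (tailY u) v + G u (tailY v)) →
  ⟪ f ∣ lincomb cs ∣ lincomb ds ⟫ ≡ 0ℚ
bilinear-annihilated cs ds as bs f F G split = begin
  ⟨ (λ u → ⟨ f u ∣ L₂ ⟩) ∣ L₁ ⟩              ≡⟨ ⟨⟩-cong-on L₁ (A0-support cs as) first ⟩
  ⟨ (λ u → ⟨ F u ∣ L₂ ⟩) ∘ tailY ∣ L₁ ⟩      ≡⟨ tailY-annihilated cs as (λ u → ⟨ F u ∣ L₂ ⟩) ⟩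
  0ℚ                                          ∎
  where
  L₁ L₂ : Elem
  L₁ = lincomb cs
  L₂ = lincomb ds
  first : ∀ u → Blocks⁺ u → ⟨ f u ∣ L₂ ⟩ ≡ ⟨ F (tailY u) ∣ L₂ ⟩
  first u bu = begin
    ⟨ f u ∣ L₂ ⟩
      ≡⟨ ⟨⟩-cong-on L₂ (A0-support ds bs) (λ v bv → split u v bu bv) ⟩
    ⟨ (λ v → F (tailY u) v + G u (tailY v)) ∣ L₂ ⟩
      ≡⟨ ⟨⟩-+ (F (tailY u)) (G u ∘ tailY) L₂ ⟩
    ⟨ F (tailY u) ∣ L₂ ⟩ + ⟨ G u ∘ tailY ∣ L₂ ⟩
      ≡⟨ cong (⟨ F (tailY u) ∣ L₂ ⟩ +_) (tailY-annihilated ds bs (G u)) ⟩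
    ⟨ F (tailY u) ∣ L₂ ⟩ + 0ℚ
      ≡⟨ +-identityʳ _ ⟩
    ⟨ F (tailY u) ∣ L₂ ⟩
      ∎

⧢-y-right : ∀ g w v → ⟨ g ∣ w ⧢w (y ∷ v) ⟩ ≡ ⟨ g ∘ (y ∷_) ∣ w ⧢w v ⟩
⧢-y-right g [] v = refl
⧢-y-right g (π ∷ w) v = ⟨⟩-◃ g y ((π ∷ w) ⧢w v)
⧢-y-right g (δ ∷ w) v = ⟨⟩-◃ g y ((δ ∷ w) ⧢w v)
⧢-y-right g (y ∷ w) v = begin
  ⟨ g ∣ y ◃ (w ⧢w (y ∷ v)) ⟩              ≡⟨ ⟨⟩-◃ g y (w ⧢w (y ∷ v)) ⟩
  ⟨ g ∘ (y ∷_) ∣ w ⧢w (y ∷ v) ⟩           ≡⟨ ⧢-y-right (g ∘ (y ∷_)) w v ⟩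
  ⟨ g ∘ (y ∷_) ∘ (y ∷_) ∣ w ⧢w v ⟩        ≡⟨ sym (⟨⟩-◃ (g ∘ (y ∷_)) y (w ⧢w v)) ⟩
  ⟨ g ∘ (y ∷_) ∣ y ◃ (w ⧢w v) ⟩           ∎

⟨⟩-π◃ : ∀ h a b c →
  ⟨ h ∣ π ◃ a ⊕ π ◃ b ⊖ π ◃ c ⟩ ≡ ⟨ h ∘ (π ∷_) ∣ a ⟩ + ⟨ h ∘ (π ∷_) ∣ b ⟩ - ⟨ h ∘ (π ∷_) ∣ c ⟩
⟨⟩-π◃ h a b c = begin
  ⟨ h ∣ π ◃ a ⊕ π ◃ b ⊖ π ◃ c ⟩
    ≡⟨ ⟨⟩-⊖ h (π ◃ a ⊕ π ◃ b) (π ◃ c) ⟩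
  ⟨ h ∣ π ◃ a ⊕ π ◃ b ⟩ - ⟨ h ∣ π ◃ c ⟩
    ≡⟨ cong₂ _-_ (⟨⟩-++ h (π ◃ a) (π ◃ b)) (⟨⟩-◃ h π c) ⟩
  ⟨ h ∣ π ◃ a ⟩ + ⟨ h ∣ π ◃ b ⟩ - ⟨ h ∘ (π ∷_) ∣ c ⟩
    ≡⟨ cong₂ (λ p q → p + q - ⟨ h ∘ (π ∷_) ∣ c ⟩) (⟨⟩-◃ h π a) (⟨⟩-◃ h π b) ⟩
  ⟨ h ∘ (π ∷_) ∣ a ⟩ + ⟨ h ∘ (π ∷_) ∣ b ⟩ - ⟨ h ∘ (π ∷_) ∣ c ⟩
    ∎

stripπ-shuffle : ∀ h u v → YHeaded u → YHeaded v →
  ⟨ h ∘ stripπ ∣ u ⧢w v ⟩ ≡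
    ⟨ h ∘ (y ∷_) ∣ tailY u ⧢w v ⟩ + ⟨ h ∘ (y ∷_) ∣ u ⧢w tailY v ⟩
      - ⟨ h ∘ (y ∷_) ∘ (y ∷_) ∣ tailY u ⧢w tailY v ⟩
stripπ-shuffle h (y ∷ u) v _ _ = begin
  ⟨ h ∘ stripπ ∣ y ◃ (u ⧢w v) ⟩
    ≡⟨ ⟨⟩-◃ (h ∘ stripπ) y (u ⧢w v) ⟩
  A
    ≡⟨ solve 2 (λ a b → a := a :+ b :- b) refl A B ⟩
  A + B - B
    ≡⟨ cong (λ z → A + z - B) (sym (⟨⟩-◃ (h ∘ (y ∷_)) y (u ⧢w tailY v))) ⟩
  A + ⟨ h ∘ (y ∷_) ∣ y ◃ (u ⧢w tailY v) ⟩ - B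
    ∎
  where
  A B : ℚ
  A = ⟨ h ∘ (y ∷_) ∣ u ⧢w v ⟩
  B = ⟨ h ∘ (y ∷_) ∘ (y ∷_) ∣ u ⧢w tailY v ⟩
stripπ-shuffle h (π ∷ u) (y ∷ v) _ _ = begin
  ⟨ h ∘ stripπ ∣ y ◃ ((π ∷ u) ⧢w v) ⟩
    ≡⟨ ⟨⟩-◃ (h ∘ stripπ) y ((π ∷ u) ⧢w v) ⟩
  A
    ≡⟨ solve 2 (λ a b → a := b :+ a :- b) refl A B ⟩
  B + A - B
    ≡⟨ cong (λ z → z + A - B) (sym (⧢-y-right (h ∘ (y ∷_)) (tailY u) v)) ⟩
  ⟨ h ∘ (y ∷_) ∣ tailY u ⧢w (y ∷ v) ⟩ + A - B
    ∎
  where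
  A B : ℚ
  A = ⟨ h ∘ (y ∷_) ∣ (π ∷ u) ⧢w v ⟩
  B = ⟨ h ∘ (y ∷_) ∘ (y ∷_) ∣ tailY u ⧢w v ⟩
stripπ-shuffle h (π ∷ u) (π ∷ v) hu hv = begin
  ⟨ h ∘ stripπ ∣ π ◃ (u ⧢w (π ∷ v)) ⊕ π ◃ ((π ∷ u) ⧢w v) ⊖ π ◃ (u ⧢w v) ⟩
    ≡⟨ ⟨⟩-π◃ (h ∘ stripπ) (u ⧢w (π ∷ v)) ((π ∷ u) ⧢w v) (u ⧢w v) ⟩
  ⟨ h ∘ stripπ ∣ u ⧢w (π ∷ v) ⟩ + ⟨ h ∘ stripπ ∣ (π ∷ u) ⧢w v ⟩ - ⟨ h ∘ stripπ ∣ u ⧢w v ⟩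
    ≡⟨ cong₂ _-_ (cong₂ _+_ (stripπ-shuffle h u (π ∷ v) hu hv) (stripπ-shuffle h (π ∷ u) v hu hv))
                 (stripπ-shuffle h u v hu hv) ⟩
  (Y (T u ⧢w (π ∷ v)) + Y (u ⧢w T v) - YY) + (Y (T u ⧢w v) + Y ((π ∷ u) ⧢w T v) - YY)
    - (Y (T u ⧢w v) + Y (u ⧢w T v) - YY)
    ≡⟨ solve 5 (λ a b c d e → (a :+ b :- c) :+ (d :+ e :- c) :- (d :+ b :- c) := a :+ e :- c)
         refl (Y (T u ⧢w (π ∷ v))) (Y (u ⧢w T v)) YY (Y (T u ⧢w v)) (Y ((π ∷ u) ⧢w T v)) ⟩
  Y (T u ⧢w (π ∷ v)) + Y ((π ∷ u) ⧢w T v) - YY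
    ∎
  where
  T : Word → Word
  T = tailY
  Y : Elem → ℚ
  Y a = ⟨ h ∘ (y ∷_) ∣ a ⟩
  YY : ℚ
  YY = ⟨ h ∘ (y ∷_) ∘ (y ∷_) ∣ tailY u ⧢w tailY v ⟩

stripπ-annihilated : ∀ cs ds → Admissibles cs → Admissibles ds → ∀ h →
  ⟨ h ∘ stripπ ∣ lincomb cs ⧢ lincomb ds ⟩ ≡ 0ℚ
stripπ-annihilated cs ds as bs h =
  trans (⟨⟩-⧢ (h ∘ stripπ) (lincomb cs) (lincomb ds))
    (bilinear-annihilated cs ds as bs _ F G split)
  where
  F G : Word → Word → ℚ
  F u′ v = ⟨ h ∘ (y ∷_) ∣ u′ ⧢w v ⟩
  G u v′ = ⟨ h ∘ (y ∷_) ∣ u ⧢w v′ ⟩ - ⟨ h ∘ (y ∷_) ∘ (y ∷_) ∣ tailY u ⧢w v′ ⟩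
  split : ∀ u v → Blocks⁺ u → Blocks⁺ v →
    ⟨ h ∘ stripπ ∣ u ⧢w v ⟩ ≡ F (tailY u) v + G u (tailY v)
  split u v bu bv =
    trans (stripπ-shuffle h u v (Blocks⁺-YHeaded u bu) (Blocks⁺-YHeaded v bv))
      (+-assoc (F (tailY u) v) _ _)

Denotes : Elem → Word → Set
Denotes a w = ∀ g → ⟨ g ∣ a ⟩ ≡ g w

word-denotes : ∀ w → Denotes (word w) w
word-denotes w g = ⟨⟩-word g w

⊙-denoted : ∀ b {q} → Denotes b q → ∀ g a → ⟨ g ∣ a ⊙ b ⟩ ≡ ⟨ (λ u → g (u ++ q)) ∣ a ⟩
⊙-denoted b db g a = trans (⟨⟩-⊙ g a b) (⟨⟩-cong (λ u → db (g ∘ (u ++_))) a)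

⊙-denotes : ∀ a b {p q} → Denotes a p → Denotes b q → Denotes (a ⊙ b) (p ++ q)
⊙-denotes a b {q = q} da db g = trans (⊙-denoted b db g a) (da (λ u → g (u ++ q)))

πpower-denotes : ∀ k → Denotes (word (π ∷ []) ^ k) (replicate k π)
πpower-denotes zero = word-denotes []
πpower-denotes (suc k) =
  ⊙-denotes (word (π ∷ [])) (word (π ∷ []) ^ k) (word-denotes (π ∷ [])) (πpower-denotes k)

πpower-y-denotes : ∀ k → Denotes ((word (π ∷ []) ^ k) ⊙ word (y ∷ [])) (replicate k π ++ y ∷ [])
πpower-y-denotes k =
  ⊙-denotes (word (π ∷ []) ^ k) (word (y ∷ [])) (πpower-denotes k) (word-denotes (y ∷ []))

-- The blocks (0 , a₁) (0 , a₂) ⋯ spelling π^a w = π^{a₁} y π^{a₂} y ⋯.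
blocksFrom : ℕ → Word → List (ℕ × ℕ)
blocksFrom a [] = []
blocksFrom a (π ∷ w) = blocksFrom (suc a) w
blocksFrom a (y ∷ w) = (0 , a) ∷ blocksFrom 0 w
blocksFrom a (δ ∷ w) = []

πs-shift : ∀ a w → replicate a π ++ π ∷ w ≡ replicate (suc a) π ++ w
πs-shift zero w = refl
πs-shift (suc a) w = cong (π ∷_) (πs-shift a w)

Blocks-dropπs : ∀ a w → Blocks (replicate a π ++ w) → Blocks w
Blocks-dropπs zero w bw = bw
Blocks-dropπs (suc a) w (_ , bw) = Blocks-dropπs a w bw

Blocks-πend : ∀ a → ¬ Blocks (replicate (suc a) π ++ [])
Blocks-πend zero (() , _)
Blocks-πend (suc a) (_ , bw) = Blocks-πend a bw

blocksFrom-denotes : ∀ a w → Blocks (replicate a π ++ w) →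
  Denotes (genWord (blocksFrom a w)) (replicate a π ++ w)
blocksFrom-denotes zero [] _ = word-denotes []
blocksFrom-denotes (suc a) [] bw = ⊥-elim (Blocks-πend a bw)
blocksFrom-denotes a (π ∷ w) bw =
  subst (Denotes (genWord (blocksFrom (suc a) w))) (sym (πs-shift a w))
    (blocksFrom-denotes (suc a) w (subst Blocks (πs-shift a w) bw))
blocksFrom-denotes a (y ∷ w) bw =
  subst (Denotes (genWord (blocksFrom a (y ∷ w)))) (++-assoc (replicate a π) (y ∷ []) w)
    (⊙-denotes (block (0 , a)) (genWord (blocksFrom 0 w))
       (⊙-denotes 𝟏 ((word (π ∷ []) ^ a) ⊙ word (y ∷ [])) (word-denotes []) (πpower-y-denotes a))
       (blocksFrom-denotes 0 w (Blocks-dropπs a (y ∷ w) bw)))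
blocksFrom-denotes a (δ ∷ w) bw = ⊥-elim (Blocks-dropπs a (δ ∷ w) bw)

ρ-block-difference : ∀ m t → Blocks t → ∀ g →
  ⟨ g ∣ genWord ((1 , suc m) ∷ blocksFrom 0 t) ⟩ ≡
    g (π ∷ (replicate m π ++ y ∷ t)) - g (replicate m π ++ y ∷ t)
ρ-block-difference m t bt g = begin
  ⟨ g ∣ ((ρ ⊙ 𝟏) ⊙ R) ⊙ genWord (blocksFrom 0 t) ⟩
    ≡⟨ ⊙-denoted (genWord (blocksFrom 0 t)) (blocksFrom-denotes 0 t bt) g ((ρ ⊙ 𝟏) ⊙ R) ⟩
  ⟨ (λ u → g (u ++ t)) ∣ (ρ ⊙ 𝟏) ⊙ R ⟩
    ≡⟨ ⊙-denoted R (πpower-y-denotes m) (λ u → g (u ++ t)) (ρ ⊙ 𝟏) ⟩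
  ⟨ g′ ∣ ρ ⊙ 𝟏 ⟩
    ≡⟨ ⟨⟩-ρ⊙ g′ 𝟏 ⟩
  ⟨ g′ ∘ (π ∷_) ∣ 𝟏 ⟩ - ⟨ g′ ∣ 𝟏 ⟩
    ≡⟨ cong₂ _-_ (word-denotes [] (g′ ∘ (π ∷_))) (word-denotes [] g′) ⟩
  g (π ∷ (r ++ t)) - g (r ++ t)
    ≡⟨ cong (λ w → g (π ∷ w) - g w) (++-assoc (replicate m π) (y ∷ []) t) ⟩
  g (π ∷ (replicate m π ++ y ∷ t)) - g (replicate m π ++ y ∷ t)
    ∎
  where
  R : Elem
  R = (word (π ∷ []) ^ m) ⊙ word (y ∷ [])
  r : Word
  r = replicate m π ++ y ∷ []
  g′ : Word → ℚ
  g′ u = g ((u ++ r) ++ t)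

-- For w = π^m y t: the admissible indices of ρ π^j y t (j < m), each with
-- coefficient c.
telescope : ℚ → Word → List (ℚ × List (ℕ × ℕ))
telescope c (π ∷ w) = (c , (1 , suc (leadπ w)) ∷ blocksFrom 0 (tailY w)) ∷ telescope c w
telescope c _ = []

telescope-step : ∀ w → YHeaded w → Blocks (tailY w) → ∀ g →
  ⟨ g ∣ genWord ((1 , suc (leadπ w)) ∷ blocksFrom 0 (tailY w)) ⟩ ≡ g (π ∷ w) - g w
telescope-step w hw bt g =
  trans (ρ-block-difference (leadπ w) (tailY w) bt g)
    (sym (cong (λ v → g (π ∷ v) - g v) (YHeaded-split w hw)))

telescope-sum : ∀ c w → YHeaded w → Blocks (tailY w) → ∀ g →
  ⟨ g ∣ lincomb (telescope c w) ⟩ + c * g (stripπ w) ≡ c * g w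
telescope-sum c (y ∷ w) _ _ g = +-identityˡ _
telescope-sum c (π ∷ w) hw bt g = begin
  ⟨ g ∣ c ·ₛ genWord i ++ lincomb (telescope c w) ⟩ + c * g (stripπ w)
    ≡⟨ cong (_+ c * g (stripπ w)) (⟨⟩-++ g (c ·ₛ genWord i) (lincomb (telescope c w))) ⟩
  ⟨ g ∣ c ·ₛ genWord i ⟩ + S + c * g (stripπ w)
    ≡⟨ +-assoc ⟨ g ∣ c ·ₛ genWord i ⟩ S (c * g (stripπ w)) ⟩
  ⟨ g ∣ c ·ₛ genWord i ⟩ + (S + c * g (stripπ w))
    ≡⟨ cong₂ _+_ (trans (⟨⟩-·ₛ g c (genWord i)) (cong (c *_) (telescope-step w hw bt g)))
                 (telescope-sum c w hw bt g) ⟩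
  c * (g (π ∷ w) - g w) + c * g w
    ≡⟨ solve 3 (λ c p q → c :* (p :- q) :+ c :* q := c :* p) refl c (g (π ∷ w)) (g w) ⟩
  c * g (π ∷ w)
    ∎
  where
  i : List (ℕ × ℕ)
  i = (1 , suc (leadπ w)) ∷ blocksFrom 0 (tailY w)
  S : ℚ
  S = ⟨ g ∣ lincomb (telescope c w) ⟩

decompose : Elem → List (ℚ × List (ℕ × ℕ))
decompose [] = []
decompose ((c , w) ∷ X) = telescope c w ++ decompose X

lincomb-++ : ∀ p q → lincomb (p ++ q) ≡ lincomb p ⊕ lincomb q
lincomb-++ [] q = refl
lincomb-++ ((c , i) ∷ p) q =
  trans (cong (c ·ₛ genWord i ++_) (lincomb-++ p q))
    (sym (++-assoc (c ·ₛ genWord i) (lincomb p) (lincomb q)))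

decomposition : ∀ h X → AllWords Blocks⁺ X →
  ⟨ h ∣ X ⟩ ≡ ⟨ h ∣ lincomb (decompose X) ⟩ + ⟨ h ∘ stripπ ∣ X ⟩
decomposition h [] [] = sym (+-identityˡ 0ℚ)
decomposition h ((c , w) ∷ X) (bw ∷ bX) = begin
  c * h w + ⟨ h ∣ X ⟩
    ≡⟨ cong₂ _+_ (sym (telescope-sum c w (Blocks⁺-YHeaded w bw) (Blocks⁺-tailY w bw) h))
                 (decomposition h X bX) ⟩
  (P + c * h (stripπ w)) + (Q + E)
    ≡⟨ solve 4 (λ p s q e → (p :+ s) :+ (q :+ e) := (p :+ q) :+ (s :+ e))
         refl P (c * h (stripπ w)) Q E ⟩
  (P + Q) + (c * h (stripπ w) + E)
    ≡⟨ cong (_+ (c * h (stripπ w) + E)) (sym lincomb-decompose) ⟩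
  ⟨ h ∣ lincomb (telescope c w ++ decompose X) ⟩ + ⟨ h ∘ stripπ ∣ (c , w) ∷ X ⟩
    ∎
  where
  P Q E : ℚ
  P = ⟨ h ∣ lincomb (telescope c w) ⟩
  Q = ⟨ h ∣ lincomb (decompose X) ⟩
  E = ⟨ h ∘ stripπ ∣ X ⟩
  lincomb-decompose : ⟨ h ∣ lincomb (telescope c w ++ decompose X) ⟩ ≡ P + Q
  lincomb-decompose =
    trans (cong (λ a → ⟨ h ∣ a ⟩) (lincomb-++ (telescope c w) (decompose X)))
      (⟨⟩-++ h (lincomb (telescope c w)) (lincomb (decompose X)))

blocksFrom-valid : ∀ a w → All (λ b → proj₁ b ≤ proj₂ b) (blocksFrom a w)
blocksFrom-valid a [] = []
blocksFrom-valid a (π ∷ w) = blocksFrom-valid (suc a) w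
blocksFrom-valid a (y ∷ w) = z≤n ∷ blocksFrom-valid 0 w
blocksFrom-valid a (δ ∷ w) = []

telescope-admissible : ∀ c w → Admissibles (telescope c w)
telescope-admissible c [] = []
telescope-admissible c (π ∷ w) =
  adm (s≤s z≤n) (s≤s z≤n) (blocksFrom-valid 0 (tailY w)) ∷ telescope-admissible c w
telescope-admissible c (δ ∷ w) = []
telescope-admissible c (y ∷ w) = []

decompose-admissible : ∀ X → Admissibles (decompose X)
decompose-admissible [] = []
decompose-admissible ((c , w) ∷ X) = ++⁺ (telescope-admissible c w) (decompose-admissible X)

proposition9p1 : (u v : Elem) → InAG0 u → InAG0 v → InAG0 (u ⧢ v)
proposition9p1 u v (cs , as , u≈) (ds , bs , v≈) =
  decompose X , decompose-admissible X , ≋⇒≈ (u ⧢ v) (lincomb (decompose X)) equal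
  where
  X : Elem
  X = lincomb cs ⧢ lincomb ds
  X-support : AllWords Blocks⁺ X
  X-support = AllWords-⧢ (lincomb cs) (lincomb ds) (A0-support cs as) (A0-support ds bs)
    (λ u′ v′ bu bv → shuffle-Blocks⁺ u′ v′ bu (proj₂ bv))
  equal : (u ⧢ v) ≋ lincomb (decompose X)
  equal h = begin
    ⟨ h ∣ u ⧢ v ⟩
      ≡⟨ ⧢-cong u (lincomb cs) v (lincomb ds) (≈⇒≋ u (lincomb cs) u≈) (≈⇒≋ v (lincomb ds) v≈) h ⟩
    ⟨ h ∣ X ⟩
      ≡⟨ decomposition h X X-support ⟩
    ⟨ h ∣ lincomb (decompose X) ⟩ + ⟨ h ∘ stripπ ∣ X ⟩
      ≡⟨ cong (⟨ h ∣ lincomb (decompose X) ⟩ +_) (stripπ-annihilated cs ds as bs h) ⟩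
    ⟨ h ∣ lincomb (decompose X) ⟩ + 0ℚ
      ≡⟨ +-identityʳ _ ⟩
    ⟨ h ∣ lincomb (decompose X) ⟩
      ∎
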